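{- Let $G$ be a non-diregular $k$-geodetic digraph that is out-regular of degree $d$ and has order $M(d,k)+\epsilon$. Let $S=\{v\in V(G): d^-(v)<d\}$. Then $S\subseteq \bigcap_{u\in V(G)} O(N^+(u))$.
   Context: $M(d,k)=1+d+\dots+d^k$. A digraph is $k$-geodetic if for any two vertices $u,v$ there is at most one directed walk from $u$ to $v$ of length at most $k$. For a vertex $u$, the outlier set $O(u)$ is the set of vertices $v$ such that there is no directed path of length at most $k$ (length $0$ allowed) from $u$ to $v$; here $|O(u)|=\epsilon$. For $X\subseteq V(G)$, $O(X)=\bigcup_{x\in X}O(x)$, and $N^+(u)$ is the out-neighbourhood of $u$. -}

module Defs where

open import Data.Nat using (ℕ; zero; suc; _+_; _*_; _^_; _≤_)
open import Data.Fin using (Fin)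
open import Data.Product using (Σ; ∃; _×_; _,_)
open import Data.List using (List; filter; length)
open import Data.List using (allFin) renaming (length to len)
open import Data.List.Relation.Unary.Unique.Propositional using (Unique)
open import Data.List.Membership.Propositional using (_∈_)
open import Function.Bundles using (_⇔_)
open import Relation.Nullary using (Dec; ¬_)
open import Relation.Binary.PropositionalEquality using (_≡_)

M : ℕ → ℕ → ℕ
M d zero    = 1
M d (suc k) = M d k + d ^ suc k

-- A digraph on vertex set Fin n, given by a decidable arc relation
-- (no parallel arcs; loops are not excluded a priori, but k-geodetic
-- with k ≥ 1 excludes them).
record Digraph (n : ℕ) : Set₁ where
  field
    Arc  : Fin n → Fin n → Set
    arc? : (u v : Fin n) → Dec (Arc u v)
open Digraph public

module _ {n : ℕ} (G : Digraph n) where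

  data Walk : Fin n → Fin n → ℕ → Set where
    here : ∀ {u} → Walk u u 0
    step : ∀ {u w v ℓ} → Arc G u w → Walk w v ℓ → Walk u v (suc ℓ)

  IsKGeodetic : ℕ → Set
  IsKGeodetic k = ∀ (u v : Fin n) (ℓ₁ ℓ₂ : ℕ) → ℓ₁ ≤ k → ℓ₂ ≤ k →
    (p : Walk u v ℓ₁) (q : Walk u v ℓ₂) →
    _≡_ {A = Σ ℕ (Walk u v)} (ℓ₁ , p) (ℓ₂ , q)

  outDeg : Fin n → ℕ
  outDeg u = len (filter (λ v → arc? G u v) (allFin n))

  inDeg : Fin n → ℕ
  inDeg v = len (filter (λ u → arc? G u v) (allFin n))

  OutRegular : ℕ → Set
  OutRegular d = ∀ u → outDeg u ≡ d

  Diregular : ℕ → Set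
  Diregular d = (∀ u → outDeg u ≡ d) × (∀ u → inDeg u ≡ d)

  Reach : ℕ → Fin n → Fin n → Set
  Reach k u v = Σ ℕ λ ℓ → ℓ ≤ k × Walk u v ℓ

  -- v ∈ O(u): no walk of length ≤ k from u to v
  -- (existence of a walk of length ≤ k is equivalent to existence of a path of length ≤ k)
  InOutlier : ℕ → Fin n → Fin n → Set
  InOutlier k u v = ¬ Reach k u v

  -- v ∈ O(X) where X = N⁺(u): v ∈ O(x) for some out-neighbour x of u
  InOutlierOfOutNbhd : ℕ → Fin n → Fin n → Set
  InOutlierOfOutNbhd k u v = ∃ λ x → Arc G u x × InOutlier k x v

  OutlierCount : ℕ → Fin n → ℕ → Set
  OutlierCount k u ε = Σ (List (Fin n)) λ xs →
    Unique xs × length xs ≡ ε × (∀ v → v ∈ xs ⇔ InOutlier k u v)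

module Submission where

-- Suppose some vertex v with d⁻(v) < d lay outside O(N⁺(u)), i.e. every
-- out-neighbour x of u reaches v by a walk of length ≤ k.  Prefixing the arc
-- u → x gives a walk u → x ⇝ v; send x to the last vertex before v on it.  That
-- vertex is an in-neighbour of v, and the walk from u to it has length ≤ k, so by
-- k-geodeticity it determines the walk and hence its second vertex x.  This
-- injection of N⁺(u) into N⁻(v) gives d = d⁺(u) ≤ d⁻(v) < d, a contradiction.
-- Since reachability within k steps is decidable, the negation of "every
-- out-neighbour reaches v" yields an explicit out-neighbour x with v ∈ O(x).

open import Defs
open import Data.Nat using (ℕ; _+_; _<_; _≤_)
open import Data.Fin using (Fin)
open import Relation.Nullary using (¬_)
open import Relation.Binary.PropositionalEquality using (_≡_)

open import Level using (Level)
open import Data.Nat using (zero; suc; z≤n; s≤s)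
open import Data.Nat.Properties using (≤-trans; ≤-reflexive; <⇒≱; anyUpTo?)
open import Data.Fin using (_≟_)
open import Data.Fin.Properties using (any?)
open import Data.Product using (Σ; _×_; _,_; proj₁; proj₂)
open import Data.Empty using (⊥-elim)
open import Data.List using (List; []; _∷_; length; filter; allFin)
open import Data.List.Membership.Propositional using (_∈_)
open import Data.List.Membership.Propositional.Properties
  using (∈-filter⁺; ∈-filter⁻; ∈-allFin)
open import Data.List.Relation.Unary.Any using (here; there)
open import Data.List.Relation.Unary.All using (lookup)
open import Data.List.Relation.Unary.AllPairs using (_∷_)
open import Data.List.Relation.Unary.Unique.Propositional using (Unique)
import Data.List.Relation.Unary.Unique.Propositional.Properties as Unique
open import Relation.Nullary using (Dec; yes; no; ¬?)
open import Relation.Nullary.Decidable using (_×-dec_; map′; decidable-stable)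
open import Relation.Unary using (Pred; Decidable)
open import Relation.Binary.PropositionalEquality using (refl; sym; cong)
open import Relation.Binary.PropositionalEquality using (module ≡-Reasoning)

module _ {a b : Level} {A : Set a} {B : Set b} where

  removeMember : ∀ {y : B} {ys : List B} → y ∈ ys →
    Σ (List B) λ zs → length ys ≡ suc (length zs) ×
                      (∀ {z} → z ∈ ys → ¬ z ≡ y → z ∈ zs)
  removeMember {ys = _ ∷ ys} (here refl) = ys , refl , keep
    where
    keep : ∀ {z} → z ∈ _ ∷ ys → ¬ z ≡ _ → z ∈ ys
    keep (here refl) z≢y = ⊥-elim (z≢y refl)
    keep (there z∈ys) _  = z∈ys
  removeMember {ys = x ∷ _} (there y∈ys) with removeMember y∈ys
  ... | zs , len , keep = x ∷ zs , cong suc len , keep′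
    where
    keep′ : ∀ {z} → z ∈ x ∷ _ → ¬ z ≡ _ → z ∈ x ∷ zs
    keep′ (here refl) _    = here refl
    keep′ (there z∈ys) z≢y = there (keep z∈ys z≢y)

  injection⇒length≤ : ∀ {xs : List A} (ys : List B) → Unique xs →
    (f : ∀ {x} → x ∈ xs → B) → (∀ {x} (p : x ∈ xs) → f p ∈ ys) →
    (∀ {x x′} (p : x ∈ xs) (p′ : x′ ∈ xs) → f p ≡ f p′ → x ≡ x′) →
    length xs ≤ length ys
  injection⇒length≤ {[]}     ys _ _ _ _ = z≤n
  injection⇒length≤ {x ∷ xs} ys (x∉xs ∷ unique) f into inj
    with removeMember (into (here refl))
  ... | zs , len , keep = ≤-trans (s≤s rest) (≤-reflexive (sym len))
    where
    rest : length xs ≤ length zs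
    rest = injection⇒length≤ zs unique (λ p → f (there p))
      (λ p → keep (into (there p))
                  (λ e → lookup x∉xs p (inj (here refl) (there p) (sym e))))
      (λ p p′ → inj (there p) (there p′))

filter-injection⇒≤ : ∀ {p q} {m m′ : ℕ} {P : Pred (Fin m) p} {Q : Pred (Fin m′) q}
  (P? : Decidable P) (Q? : Decidable Q) (f : ∀ {x} → P x → Fin m′) →
  (∀ {x} (px : P x) → Q (f px)) →
  (∀ {x x′} (px : P x) (px′ : P x′) → f px ≡ f px′ → x ≡ x′) →
  length (filter P? (allFin m)) ≤ length (filter Q? (allFin m′))
filter-injection⇒≤ {m = m} {m′} {P} P? Q? f inQ inj =
  injection⇒length≤ (filter Q? (allFin m′))
    (Unique.filter⁺ P? (Unique.allFin⁺ m))
    (λ x∈ → f (holds x∈))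
    (λ x∈ → ∈-filter⁺ Q? (∈-allFin _) (inQ (holds x∈)))
    (λ x∈ x′∈ → inj (holds x∈) (holds x′∈))
  where
  holds : ∀ {x} → x ∈ filter P? (allFin m) → P x
  holds x∈ = proj₂ (∈-filter⁻ P? {xs = allFin m} x∈)

module _ {n : ℕ} (G : Digraph n) where

  walk? : (ℓ : ℕ) (x v : Fin n) → Dec (Walk G x v ℓ)
  walk? zero x v with x ≟ v
  ... | yes refl = yes here
  ... | no x≢v   = no λ { here → x≢v refl }
  walk? (suc ℓ) x v with any? (λ w → arc? G x w ×-dec walk? ℓ w v)
  ... | yes (_ , a , W) = yes (step a W)
  ... | no none         = no λ { (step a W) → none (_ , a , W) }

  reach? : (k : ℕ) (x v : Fin n) → Dec (Reach G k x v)
  reach? k x v = map′ (λ { (ℓ , s≤s ℓ≤k , W) → ℓ , ℓ≤k , W })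
                      (λ { (ℓ , ℓ≤k , W) → ℓ , s≤s ℓ≤k , W })
                      (anyUpTo? (λ ℓ → walk? ℓ x v) (suc k))

  splitLast : ∀ {u v ℓ} → Walk G u v (suc ℓ) → Σ (Fin n) λ w → Walk G u w ℓ × Arc G w v
  splitLast (step a here)       = _ , here , a
  splitLast (step a (step b W)) with splitLast (step b W)
  ... | w , Q , c = w , step a Q , c

  -- The vertex after the start of Q, once Q is extended by a final step to v.
  secondVertex : ∀ {u w ℓ} → Walk G u w ℓ → Fin n → Fin n
  secondVertex here               v = v
  secondVertex (step {w = x} _ _) _ = x

  secondVertex-splitLast : ∀ {u x v ℓ} (a : Arc G u x) (W : Walk G x v ℓ) →
    secondVertex (proj₁ (proj₂ (splitLast (step a W)))) v ≡ x
  secondVertex-splitLast a here       = refl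
  secondVertex-splitLast a (step b W) with splitLast (step b W)
  ... | _ = refl

  -- In a k-geodetic digraph, if every out-neighbour of u reaches v within k
  -- steps then d⁺(u) ≤ d⁻(v): the last vertex before v on u → x ⇝ v is an
  -- in-neighbour of v that determines x.
  outDeg≤inDeg : ∀ {k u v} → IsKGeodetic G k →
    (∀ x → Arc G u x → Reach G k x v) → outDeg G u ≤ inDeg G v
  outDeg≤inDeg {k} {u} {v} geodetic reaches =
    filter-injection⇒≤ (arc? G u) (λ w → arc? G w v) penultimate
      (λ a → proj₂ (proj₂ (splitFrom a)))
      injective
    where
    splitFrom : ∀ {x} (a : Arc G u x) →
      Σ (Fin n) λ w → Walk G u w (proj₁ (reaches x a)) × Arc G w v
    splitFrom {x} a = splitLast (step a (proj₂ (proj₂ (reaches x a))))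

    penultimate : ∀ {x} → Arc G u x → Fin n
    penultimate a = proj₁ (splitFrom a)

    prefix : ∀ {x} (a : Arc G u x) → Walk G u (penultimate a) (proj₁ (reaches x a))
    prefix a = proj₁ (proj₂ (splitFrom a))

    sameEnd⇒sameSecond : ∀ {w w′ ℓ ℓ′} → ℓ ≤ k → ℓ′ ≤ k →
      (Q : Walk G u w ℓ) (Q′ : Walk G u w′ ℓ′) → w ≡ w′ →
      secondVertex Q v ≡ secondVertex Q′ v
    sameEnd⇒sameSecond ℓ≤k ℓ′≤k Q Q′ refl =
      cong (λ walk → secondVertex (proj₂ walk) v) (geodetic u _ _ _ ℓ≤k ℓ′≤k Q Q′)

    injective : ∀ {x x′} (a : Arc G u x) (a′ : Arc G u x′) →
      penultimate a ≡ penultimate a′ → x ≡ x′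
    injective {x} {x′} a a′ same = begin
      x                         ≡⟨ sym (secondVertex-splitLast a W) ⟩
      secondVertex (prefix a) v  ≡⟨ sameEnd⇒sameSecond ℓ≤k ℓ′≤k (prefix a) (prefix a′) same ⟩
      secondVertex (prefix a′) v ≡⟨ secondVertex-splitLast a′ W′ ⟩
      x′                        ∎
      where
      open ≡-Reasoning
      ℓ≤k : proj₁ (reaches x a) ≤ k
      ℓ≤k = proj₁ (proj₂ (reaches x a))
      W : Walk G x v (proj₁ (reaches x a))
      W = proj₂ (proj₂ (reaches x a))
      ℓ′≤k : proj₁ (reaches x′ a′) ≤ k
      ℓ′≤k = proj₁ (proj₂ (reaches x′ a′))
      W′ : Walk G x′ v (proj₁ (reaches x′ a′))
      W′ = proj₂ (proj₂ (reaches x′ a′))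

lemma2 : (d k ε n : ℕ) → (G : Digraph n) → 1 ≤ d → 1 ≤ k →
    IsKGeodetic G k → OutRegular G d → ¬ Diregular G d →
    n ≡ M d k + ε → (∀ u → OutlierCount G k u ε) →
    ∀ (v : Fin n) → inDeg G v < d → ∀ (u : Fin n) → InOutlierOfOutNbhd G k u v
lemma2 d k ε n G _ _ geodetic outRegular _ _ _ v inDeg<d u
  with any? (λ x → arc? G u x ×-dec ¬? (reach? G k x v))
... | yes missing = missing
... | no noneMissing = ⊥-elim (<⇒≱ inDeg<d d≤inDeg)
  where
  reachesAll : ∀ x → Arc G u x → Reach G k x v
  reachesAll x a = decidable-stable (reach? G k x v) (λ miss → noneMissing (x , a , miss))

  d≤inDeg : d ≤ inDeg G v
  d≤inDeg = ≤-trans (≤-reflexive (sym (outRegular u))) (outDeg≤inDeg G geodetic reachesAll)
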